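{- Let $\Gamma=(V,E)$ be a reflexive finite $k$-separable graph such that $\Gamma^-$ is not $k$-faithful. Then: (i) the intersection of two distinct $k$-super-fragments of $\Gamma$ has cardinality less than $k$; (ii) moreover, if $k\ge2$ and $\kappa_k(\Gamma)=\kappa_{k-1}(\Gamma)$, then the intersection of two distinct $k$-super-fragments of $\Gamma$ has cardinality less than $k-1$.
   Context: A graph is a pair $\Gamma=(V,E)$ with $E\subseteq V\times V$; it is finite if $V$ is finite. For $X\subseteq V$, $\Gamma(X)=\{y: (x,y)\in E\text{ for some }x\in X\}$. $\Gamma$ is reflexive if $(x,x)\in E$ for all $x$. The reverse graph is $\Gamma^-=(V,\{(x,y):(y,x)\in E\})$. Board $\partial(X)=\Gamma(X)\setminus X$, exterior $\nabla(X)=V\setminus\Gamma(X)$. For $k\ge1$, $\Gamma$ is $k$-separable if some $X$ has $|X|\ge k$ and $|\nabla(X)|\ge k$; then $\kappa_k(\Gamma)=\min|\partial(X)|$ over such $X$. A $k$-fragment is a set $X$ with $|X|\ge k$, $|\nabla(X)|\ge k$ and $|\partial(X)|=\kappa_k(\Gamma)$; a $k$-atom is a $k$-fragment of minimum cardinality; a $k$-super-fragment is a $k$-fragment of maximum cardinality. A graph is $k$-faithful if $|A|\le|\nabla(A)|$ for its $k$-atoms $A$ (exterior computed in that graph). -}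

module Defs where

open import Data.Nat using (ℕ; _≤_; _<_; _∸_)
open import Data.Bool using (Bool; true; _∧_)
open import Data.Fin using (Fin)
open import Data.Fin.Subset using (Subset; ∁; _─_; ∣_∣)
open import Data.Vec using (tabulate; lookup)
open import Data.List using (allFin)
open import Data.Bool.ListAction using (any)
open import Data.Product using (Σ; _×_)
open import Relation.Binary.PropositionalEquality using (_≡_)

-- A finite graph on vertex set Fin n; E x y ≡ true means (x , y) ∈ E.
Graph : ℕ → Set
Graph n = Fin n → Fin n → Bool

module _ {n : ℕ} where

  Reflexive : Graph n → Set
  Reflexive E = ∀ x → E x x ≡ true

  rev : Graph n → Graph n
  rev E x y = E y x

  nbhd : Graph n → Subset n → Subset n
  nbhd E X = tabulate (λ y → any (λ x → lookup X x ∧ E x y) (allFin n))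

  board : Graph n → Subset n → Subset n
  board E X = nbhd E X ─ X

  exterior : Graph n → Subset n → Subset n
  exterior E X = ∁ (nbhd E X)

  Admissible : ℕ → Graph n → Subset n → Set
  Admissible k E X = (k ≤ ∣ X ∣) × (k ≤ ∣ exterior E X ∣)

  Separable : ℕ → Graph n → Set
  Separable k E = Σ (Subset n) (Admissible k E)

  IsKappa : ℕ → Graph n → ℕ → Set
  IsKappa k E c =
    Σ (Subset n) (λ X → Admissible k E X × ∣ board E X ∣ ≡ c)
    × (∀ Y → Admissible k E Y → c ≤ ∣ board E Y ∣)

  -- k-fragment: admissible with |∂(X)| = κ_k(Γ) (i.e. minimal board among admissible sets)
  Fragment : ℕ → Graph n → Subset n → Set
  Fragment k E X = Admissible k E X × (∀ Y → Admissible k E Y → ∣ board E X ∣ ≤ ∣ board E Y ∣)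

  Atom : ℕ → Graph n → Subset n → Set
  Atom k E A = Fragment k E A × (∀ Y → Fragment k E Y → ∣ A ∣ ≤ ∣ Y ∣)

  SuperFragment : ℕ → Graph n → Subset n → Set
  SuperFragment k E X = Fragment k E X × (∀ Y → Fragment k E Y → ∣ Y ∣ ≤ ∣ X ∣)

  Faithful : ℕ → Graph n → Set
  Faithful k E = ∀ A → Atom k E A → ∣ A ∣ ≤ ∣ exterior E A ∣

module Submission where

-- In a reflexive graph
-- |X| + |∂X| + |∇X| = |V|, and both X ↦ |Γ X| and X ↦ |∂ X| are submodular.
--
-- Duality: ∇⁻ A (the exterior of A in Γ⁻) receives no edge into A, so
-- A ⊆ ∇(∇⁻ A) and ∂(∇⁻ A) ⊆ ∂⁻ A.  Consequently the exterior of a k-fragment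
-- of Γ is a k-fragment of Γ⁻, and comparing the partitions of V induced by a
-- fragment X of Γ and an atom A of Γ⁻ shows: if |∇X| ≤ |X| then Γ⁻ is
-- k-faithful.  So, when Γ⁻ is not k-faithful, every k-fragment X satisfies
-- |X| < |∇X|.
--
-- Main step: if X, Y are k-fragments, |X| < |∇Y|, |X ∩ Y| ≥ k - 1 and
-- |∂(X ∩ Y)| ≥ |∂X|, then submodularity makes X ∪ Y a k-fragment.  For
-- distinct super-fragments this contradicts maximality.  Both parts of the
-- theorem supply the bound |∂(X ∩ Y)| ≥ |∂X| by observing that X ∩ Y is
-- admissible for κ_k (part i) resp. for κ_{k-1} = κ_k (part ii).

open import Defs
open import Data.Nat using (ℕ; _≤_; _<_; _∸_)
open import Data.Fin.Subset using (Subset; _∩_; ∣_∣)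
open import Data.Product using (_×_)
open import Relation.Nullary using (¬_)
open import Relation.Binary.PropositionalEquality using (_≡_; _≢_)

open import Data.Nat using (suc; _+_; s≤s)
open import Data.Nat.Properties
open import Data.Nat.Tactic.RingSolver using (solve-∀)
open import Data.Bool using (true; T)
open import Data.Bool.Properties using (T-≡; T-∧)
open import Data.Fin.Subset using (_∪_; ∁; _─_; _∈_; _∉_; _⊆_; inside; outside)
open import Data.Fin.Subset.Properties
  using ( ∣p∣≤n; ∣∁p∣≡n∸∣p∣; p⊆q⇒∣p∣≤∣q∣; drop-∷-⊆; x∈p∩q⁺; x∈p∪q⁻; p∩q⊆p; p∩q⊆q
        ; p⊆p∪q; q⊆p∪q; x∈∁p⇒x∉p; x∉∁p⇒x∈p; x∉p⇒x∈∁p; p⊆q⇒∁p⊇∁q; x∈p∧x∉q⇒x∈p─q; p─q⊆p )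
open import Data.Vec using ([]; _∷_; here; there; lookup)
open import Data.Vec.Properties using (lookup∘tabulate; []=⇒lookup; lookup⇒[]=)
open import Data.List using (allFin)
open import Data.List.Relation.Unary.Any using (satisfied)
open import Data.List.Relation.Unary.Any.Properties using (any⁺; any⁻)
import Data.List.Membership.Propositional as List
open import Data.List.Membership.Propositional.Properties using (∈-allFin)
open import Data.Empty using (⊥)
open import Data.Product using (∃-syntax; _,_)
open import Data.Sum using (inj₁; inj₂)
open import Function.Bundles using (Equivalence)
open import Relation.Nullary using (contradiction)
open import Relation.Binary.PropositionalEquality using (refl; sym; trans; cong; cong₂; subst)

open Equivalence using (to; from)

module Arithmetic where
  interchange : ∀ a b c d → (a + b) + (c + d) ≡ (a + c) + (b + d)
  interchange = solve-∀

  swap-outer : ∀ a b c → a + b + c ≡ c + b + a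
  swap-outer = solve-∀

  regroup : ∀ a b c d → (a + b) + c + d ≡ (b + c) + (a + d)
  regroup = solve-∀

  regroup′ : ∀ a b c d → (a + b) + (c + d) ≡ (b + c) + (a + d)
  regroup′ = solve-∀

  balance : ∀ {a b e a′ b′ e′ m} → a + b + e ≡ m → a′ + b′ + e′ ≡ m → b ≡ b′ →
    a′ ≤ e → e ≤ a → a′ ≤ e′
  balance {a} {b} {e} {a′} {_} {e′} refl eq refl a′≤e e≤a =
    ≤-trans a′≤e (≤-trans e≤a (+-cancelˡ-≤ (a′ + b) a e′ (begin
      a′ + b + a  ≡⟨ swap-outer a′ b a ⟩
      a + b + a′  ≤⟨ +-monoʳ-≤ (a + b) a′≤e ⟩
      a + b + e   ≡⟨ sym eq ⟩
      a′ + b + e′ ∎)))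
    where open ≤-Reasoning

  -- The linear-arithmetic core of the exterior bound in union-fragment.
  -- Reading i = |X ∩ Y|, b = |∂X|, x = |X|, gZ = |Γ Z|, eZ = |∇ Z| and m = |V|.
  exterior-grows : ∀ {i b x g∩ g∪ gX gY eY e∪ m} → i + b ≤ g∩ → g∩ + g∪ ≤ gX + gY →
    x + b ≡ gX → gY + eY ≡ m → g∪ + e∪ ≡ m → x < eY → i < e∪
  exterior-grows {i} {b} {x} {g∩} {g∪} {_} {gY} {eY} {e∪} ib≤g∩ submod refl gY+eY g∪+e∪ x<eY =
    +-cancelʳ-≤ x (suc i) e∪ (begin
      suc i + x  ≡⟨ sym (+-suc i x) ⟩
      i + suc x  ≤⟨ +-monoʳ-≤ i x<eY ⟩
      i + eY     ≤⟨ +-cancelˡ-≤ (b + g∪) (i + eY) (x + e∪) shifted ⟩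
      x + e∪     ≡⟨ +-comm x e∪ ⟩
      e∪ + x     ∎)
    where
    open ≤-Reasoning
    shifted : (b + g∪) + (i + eY) ≤ (b + g∪) + (x + e∪)
    shifted = begin
      (b + g∪) + (i + eY)  ≡⟨ sym (regroup i b g∪ eY) ⟩
      (i + b) + g∪ + eY    ≤⟨ +-monoˡ-≤ eY (+-monoˡ-≤ g∪ ib≤g∩) ⟩
      g∩ + g∪ + eY         ≤⟨ +-monoˡ-≤ eY submod ⟩
      (x + b) + gY + eY    ≡⟨ +-assoc (x + b) gY eY ⟩
      (x + b) + (gY + eY)  ≡⟨ cong ((x + b) +_) (trans gY+eY (sym g∪+e∪)) ⟩
      (x + b) + (g∪ + e∪)  ≡⟨ regroup′ x b g∪ e∪ ⟩
      (b + g∪) + (x + e∪)  ∎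

  cancel-board : ∀ {bX bY β∩ β∪} → bX ≤ β∩ → β∩ + β∪ ≤ bX + bY → β∪ ≤ bY
  cancel-board {bX} {bY} {β∩} {β∪} bX≤β∩ submod =
    +-cancelˡ-≤ bX β∪ bY (≤-trans (+-monoˡ-≤ β∪ bX≤β∩) submod)

open Arithmetic

private variable
  n : ℕ

inclusion-exclusion : (p q : Subset n) → ∣ p ∩ q ∣ + ∣ p ∪ q ∣ ≡ ∣ p ∣ + ∣ q ∣
inclusion-exclusion [] [] = refl
inclusion-exclusion (inside ∷ p) (inside ∷ q) =
  cong suc (trans (+-suc _ _) (trans (cong suc (inclusion-exclusion p q)) (sym (+-suc _ _))))
inclusion-exclusion (inside ∷ p) (outside ∷ q) =
  trans (+-suc _ _) (cong suc (inclusion-exclusion p q))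
inclusion-exclusion (outside ∷ p) (inside ∷ q) =
  trans (+-suc _ _) (trans (cong suc (inclusion-exclusion p q)) (sym (+-suc _ _)))
inclusion-exclusion (outside ∷ p) (outside ∷ q) = inclusion-exclusion p q

size+complement : (p : Subset n) → ∣ p ∣ + ∣ ∁ p ∣ ≡ n
size+complement p = trans (cong (∣ p ∣ +_) (∣∁p∣≡n∸∣p∣ p)) (m+[n∸m]≡n (∣p∣≤n p))

size+difference : {p q : Subset n} → q ⊆ p → ∣ q ∣ + ∣ p ─ q ∣ ≡ ∣ p ∣
size+difference {p = []} {q = []} _ = refl
size+difference {p = inside ∷ p} {q = inside ∷ q} q⊆p = cong suc (size+difference (drop-∷-⊆ q⊆p))
size+difference {p = inside ∷ p} {q = outside ∷ q} q⊆p =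
  trans (+-suc _ _) (cong suc (size+difference (drop-∷-⊆ q⊆p)))
size+difference {p = outside ∷ p} {q = inside ∷ q} q⊆p = contradiction (q⊆p here) λ ()
size+difference {p = outside ∷ p} {q = outside ∷ q} q⊆p = size+difference (drop-∷-⊆ q⊆p)

x∈p─q⇒x∉q : {p q : Subset n} {x : _} → x ∈ p ─ q → x ∉ q
x∈p─q⇒x∉q {p = _ ∷ p} {q = outside ∷ q} (there x∈p─q) (there x∈q) = x∈p─q⇒x∉q x∈p─q x∈q
x∈p─q⇒x∉q {p = _ ∷ p} {q = inside ∷ q} (there x∈p─q) (there x∈q) = x∈p─q⇒x∉q x∈p─q x∈q

⊆-card-antisym : {p q : Subset n} → p ⊆ q → ∣ q ∣ ≤ ∣ p ∣ → p ≡ q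
⊆-card-antisym {p = []} {q = []} _ _ = refl
⊆-card-antisym {p = inside ∷ p} {q = inside ∷ q} p⊆q q≤p =
  cong (inside ∷_) (⊆-card-antisym (drop-∷-⊆ p⊆q) (≤-pred q≤p))
⊆-card-antisym {p = inside ∷ p} {q = outside ∷ q} p⊆q _ = contradiction (p⊆q here) λ ()
⊆-card-antisym {p = outside ∷ p} {q = inside ∷ q} p⊆q q≤p =
  contradiction q≤p (<⇒≱ (s≤s (p⊆q⇒∣p∣≤∣q∣ (drop-∷-⊆ p⊆q))))
⊆-card-antisym {p = outside ∷ p} {q = outside ∷ q} p⊆q q≤p =
  cong (outside ∷_) (⊆-card-antisym (drop-∷-⊆ p⊆q) q≤p)

module _ {n : ℕ} (E : Graph n) where

  private
    ∈⇒T : {p : Subset n} {x : _} → x ∈ p → T (lookup p x)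
    ∈⇒T x∈p = from T-≡ ([]=⇒lookup x∈p)

    T⇒∈ : {p : Subset n} {x : _} → T (lookup p x) → x ∈ p
    T⇒∈ {p} {x} t = lookup⇒[]= x p (to T-≡ t)

  ∈-nbhd⁺ : {X : Subset n} {x y : _} → x ∈ X → E x y ≡ true → y ∈ nbhd E X
  ∈-nbhd⁺ {X} {x} {y} x∈X xy = T⇒∈ (subst T (sym (lookup∘tabulate _ y))
    (any⁺ _ (List.lose (∈-allFin x) (from T-∧ (∈⇒T x∈X , from T-≡ xy)))))

  ∈-nbhd⁻ : {X : Subset n} {y : _} → y ∈ nbhd E X → ∃[ x ] (x ∈ X × E x y ≡ true)
  ∈-nbhd⁻ {X} {y} y∈ΓX =
    let (x , t) = satisfied (any⁻ _ (allFin n) (subst T (lookup∘tabulate _ y) (∈⇒T y∈ΓX)))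
        (x∈X , xy) = to T-∧ t
    in x , T⇒∈ x∈X , to T-≡ xy

  nbhd-mono : {X Y : Subset n} → X ⊆ Y → nbhd E X ⊆ nbhd E Y
  nbhd-mono X⊆Y y∈ΓX = let (x , x∈X , xy) = ∈-nbhd⁻ y∈ΓX in ∈-nbhd⁺ (X⊆Y x∈X) xy

  nbhd-∩ : (X Y : Subset n) → nbhd E (X ∩ Y) ⊆ nbhd E X ∩ nbhd E Y
  nbhd-∩ X Y y∈ = x∈p∩q⁺ (nbhd-mono (p∩q⊆p X Y) y∈ , nbhd-mono (p∩q⊆q X Y) y∈)

  nbhd-∪ : (X Y : Subset n) → nbhd E (X ∪ Y) ⊆ nbhd E X ∪ nbhd E Y
  nbhd-∪ X Y y∈ with ∈-nbhd⁻ y∈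
  ... | x , x∈X∪Y , xy with x∈p∪q⁻ X Y x∈X∪Y
  ...   | inj₁ x∈X = p⊆p∪q _ (∈-nbhd⁺ x∈X xy)
  ...   | inj₂ x∈Y = q⊆p∪q _ _ (∈-nbhd⁺ x∈Y xy)

  nbhd-refl : Reflexive E → {X : Subset n} → X ⊆ nbhd E X
  nbhd-refl rE {x = x} x∈X = ∈-nbhd⁺ x∈X (rE x)

  size+board : Reflexive E → (X : Subset n) → ∣ X ∣ + ∣ board E X ∣ ≡ ∣ nbhd E X ∣
  size+board rE X = size+difference (nbhd-refl rE)

  partition : Reflexive E → (X : Subset n) → ∣ X ∣ + ∣ board E X ∣ + ∣ exterior E X ∣ ≡ n
  partition rE X = trans (cong (_+ ∣ exterior E X ∣) (size+board rE X)) (size+complement (nbhd E X))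

  exterior-antitone : {X Y : Subset n} → X ⊆ Y → exterior E Y ⊆ exterior E X
  exterior-antitone X⊆Y = p⊆q⇒∁p⊇∁q (nbhd-mono X⊆Y)

  meet-admissible : {j k : ℕ} (X Y : Subset n) → Admissible k E X →
    j ≤ k → j ≤ ∣ X ∩ Y ∣ → Admissible j E (X ∩ Y)
  meet-admissible X Y (_ , k≤∇X) j≤k j≤X∩Y =
    j≤X∩Y , ≤-trans j≤k (≤-trans k≤∇X (p⊆q⇒∣p∣≤∣q∣ (exterior-antitone (p∩q⊆p X Y))))

  nbhd-submodular : (X Y : Subset n) →
    ∣ nbhd E (X ∩ Y) ∣ + ∣ nbhd E (X ∪ Y) ∣ ≤ ∣ nbhd E X ∣ + ∣ nbhd E Y ∣
  nbhd-submodular X Y = ≤-trans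
    (+-mono-≤ (p⊆q⇒∣p∣≤∣q∣ (nbhd-∩ X Y)) (p⊆q⇒∣p∣≤∣q∣ (nbhd-∪ X Y)))
    (≤-reflexive (inclusion-exclusion (nbhd E X) (nbhd E Y)))

  -- X ↦ |∂ X| is submodular in a reflexive graph: subtract inclusion–exclusion
  -- for X, Y from the submodularity of |Γ _|.
  board-submodular : Reflexive E → (X Y : Subset n) →
    ∣ board E (X ∩ Y) ∣ + ∣ board E (X ∪ Y) ∣ ≤ ∣ board E X ∣ + ∣ board E Y ∣
  board-submodular rE X Y = +-cancelˡ-≤ (∣ X ∣ + ∣ Y ∣) _ _ (begin
    (∣ X ∣ + ∣ Y ∣) + (∣ ∂ (X ∩ Y) ∣ + ∣ ∂ (X ∪ Y) ∣)
      ≡⟨ cong (_+ (∣ ∂ (X ∩ Y) ∣ + ∣ ∂ (X ∪ Y) ∣)) (sym (inclusion-exclusion X Y)) ⟩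
    (∣ X ∩ Y ∣ + ∣ X ∪ Y ∣) + (∣ ∂ (X ∩ Y) ∣ + ∣ ∂ (X ∪ Y) ∣)
      ≡⟨ interchange ∣ X ∩ Y ∣ _ _ _ ⟩
    (∣ X ∩ Y ∣ + ∣ ∂ (X ∩ Y) ∣) + (∣ X ∪ Y ∣ + ∣ ∂ (X ∪ Y) ∣)
      ≡⟨ cong₂ _+_ (size+board rE (X ∩ Y)) (size+board rE (X ∪ Y)) ⟩
    ∣ nbhd E (X ∩ Y) ∣ + ∣ nbhd E (X ∪ Y) ∣
      ≤⟨ nbhd-submodular X Y ⟩
    ∣ nbhd E X ∣ + ∣ nbhd E Y ∣
      ≡⟨ sym (cong₂ _+_ (size+board rE X) (size+board rE Y)) ⟩
    (∣ X ∣ + ∣ ∂ X ∣) + (∣ Y ∣ + ∣ ∂ Y ∣)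
      ≡⟨ interchange ∣ X ∣ _ _ _ ⟩
    (∣ X ∣ + ∣ Y ∣) + (∣ ∂ X ∣ + ∣ ∂ Y ∣) ∎)
    where
    open ≤-Reasoning
    ∂ : Subset n → Subset n
    ∂ = board E

module _ {n : ℕ} (E : Graph n) where

  -- No edge of Γ leads from ∇⁻ A into A: such an edge f → a would put f in Γ⁻ A.
  exterior-rev-avoids : {A : Subset n} {y : _} → y ∈ A → y ∉ nbhd E (exterior (rev E) A)
  exterior-rev-avoids y∈A y∈Γ∇⁻A =
    let (f , f∈∇⁻A , fy) = ∈-nbhd⁻ E y∈Γ∇⁻A
    in x∈∁p⇒x∉p f∈∇⁻A (∈-nbhd⁺ (rev E) y∈A fy)

  ⊆-exterior-exterior-rev : (A : Subset n) → A ⊆ exterior E (exterior (rev E) A)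
  ⊆-exterior-exterior-rev A y∈A = x∉p⇒x∈∁p (exterior-rev-avoids y∈A)

  -- ∂(∇⁻ A) ⊆ ∂⁻ A: a board vertex of ∇⁻ A is outside ∇⁻ A, hence in Γ⁻ A,
  -- and it is not in A by exterior-rev-avoids.
  board-exterior-rev : (A : Subset n) → ∣ board E (exterior (rev E) A) ∣ ≤ ∣ board (rev E) A ∣
  board-exterior-rev A = p⊆q⇒∣p∣≤∣q∣ {p = board E F} {q = board (rev E) A} λ y∈∂ →
    let y∈ΓF = p─q⊆p (nbhd E F) F y∈∂
        y∉F = x∈p─q⇒x∉q {p = nbhd E F} y∈∂
    in x∈p∧x∉q⇒x∈p─q {q = A} (x∉∁p⇒x∈p y∉F) (λ y∈A → exterior-rev-avoids y∈A y∈ΓF)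
    where
    F : Subset n
    F = exterior (rev E) A

  exterior-rev-admissible : {k : ℕ} (A : Subset n) →
    Admissible k (rev E) A → Admissible k E (exterior (rev E) A)
  exterior-rev-admissible A (k≤A , k≤∇⁻A) =
    k≤∇⁻A , ≤-trans k≤A (p⊆q⇒∣p∣≤∣q∣ (⊆-exterior-exterior-rev A))

module _ {n k : ℕ} {E : Graph n} where

  -- The exterior of a k-fragment X of Γ is a k-fragment of Γ⁻: for every
  -- Γ⁻-admissible Z, |∂⁻(∇X)| ≤ |∂X| ≤ |∂(∇⁻ Z)| ≤ |∂⁻ Z|.
  exterior-fragment : {X : Subset n} → Fragment k E X → Fragment k (rev E) (exterior E X)
  exterior-fragment {X} (admX , minX) = exterior-rev-admissible (rev E) X admX , λ Z admZ →
    ≤-trans (board-exterior-rev (rev E) X)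
      (≤-trans (minX _ (exterior-rev-admissible E Z admZ)) (board-exterior-rev E Z))

  -- A k-fragment of Γ and a k-fragment of Γ⁻ have boards of the same size:
  -- each one's exterior is admissible for the other graph with no larger board.
  fragment-boards-rev : {X A : Subset n} → Fragment k E X → Fragment k (rev E) A →
    ∣ board E X ∣ ≡ ∣ board (rev E) A ∣
  fragment-boards-rev {X} {A} (admX , minX) (admA , minA) = ≤-antisym
    (≤-trans (minX _ (exterior-rev-admissible E A admA)) (board-exterior-rev E A))
    (≤-trans (minA _ (exterior-rev-admissible (rev E) X admX)) (board-exterior-rev (rev E) X))

  -- If some k-fragment X of Γ has |∇X| ≤ |X|, then Γ⁻ is k-faithful: for a
  -- k-atom A of Γ⁻, comparing |X| + |∂X| + |∇X| = |V| = |A| + |∂⁻A| + |∇⁻A|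
  -- with |A| ≤ |∇X| (∇X is a k-fragment of Γ⁻) gives |A| ≤ |∇⁻A|.
  faithful-if-exterior-small : Reflexive E → {X : Subset n} → Fragment k E X →
    ∣ exterior E X ∣ ≤ ∣ X ∣ → Faithful k (rev E)
  faithful-if-exterior-small rE {X} fX ∇X≤X A (fA , minimalA) =
    balance (partition E rE X) (partition (rev E) rE A) (fragment-boards-rev fX fA)
      (minimalA _ (exterior-fragment fX)) ∇X≤X

  fragment-smaller-than-exterior : Reflexive E → ¬ Faithful k (rev E) → {X : Subset n} →
    Fragment k E X → ∣ X ∣ < ∣ exterior E X ∣
  fragment-smaller-than-exterior rE nf fX = ≰⇒> λ ∇X≤X → nf (faithful-if-exterior-small rE fX ∇X≤X)

  -- If X, Y are k-fragments with |X| < |∇Y|, |X ∩ Y| ≥ k - 1 and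
  -- |∂(X ∩ Y)| ≥ |∂X|, then X ∪ Y is a k-fragment: board submodularity bounds
  -- |∂(X ∪ Y)| by |∂Y|, and neighbourhood submodularity gives |∇(X ∪ Y)| > |X ∩ Y|.
  union-fragment : Reflexive E → {X Y : Subset n} → Fragment k E X → Fragment k E Y →
    ∣ X ∣ < ∣ exterior E Y ∣ → k ≤ suc ∣ X ∩ Y ∣ → ∣ board E X ∣ ≤ ∣ board E (X ∩ Y) ∣ →
    Fragment k E (X ∪ Y)
  union-fragment rE {X} {Y} ((k≤X , _) , _) (_ , minY) X<∇Y k≤1+X∩Y ∂X≤∂X∩Y =
    (≤-trans k≤X (p⊆q⇒∣p∣≤∣q∣ (p⊆p∪q {p = X} Y)) , ≤-trans k≤1+X∩Y X∩Y<∇X∪Y) ,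
    λ Z admZ → ≤-trans ∂X∪Y≤∂Y (minY Z admZ)
    where
    ∂X∪Y≤∂Y : ∣ board E (X ∪ Y) ∣ ≤ ∣ board E Y ∣
    ∂X∪Y≤∂Y = cancel-board ∂X≤∂X∩Y (board-submodular E rE X Y)
    X∩Y<∇X∪Y : ∣ X ∩ Y ∣ < ∣ exterior E (X ∪ Y) ∣
    X∩Y<∇X∪Y = exterior-grows
      (≤-trans (+-monoʳ-≤ ∣ X ∩ Y ∣ ∂X≤∂X∩Y) (≤-reflexive (size+board E rE (X ∩ Y))))
      (nbhd-submodular E X Y) (size+board E rE X)
      (size+complement (nbhd E Y)) (size+complement (nbhd E (X ∪ Y))) X<∇Y

  -- Two distinct k-super-fragments cannot meet in ≥ k - 1 elements when the
  -- board of the intersection is at least κ_k: X ∪ Y would be a k-fragment,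
  -- so maximality forces X = X ∪ Y = Y.
  super-fragments-meet : Reflexive E → ¬ Faithful k (rev E) → {X Y : Subset n} →
    SuperFragment k E X → SuperFragment k E Y → X ≢ Y →
    k ≤ suc ∣ X ∩ Y ∣ → ∣ board E X ∣ ≤ ∣ board E (X ∩ Y) ∣ → ⊥
  super-fragments-meet rE nf {X} {Y} (fX , maxX) (fY , maxY) X≢Y k≤1+X∩Y ∂X≤∂X∩Y =
    X≢Y (trans (⊆-card-antisym (p⊆p∪q Y) (maxX _ fX∪Y))
               (sym (⊆-card-antisym (q⊆p∪q X Y) (maxY _ fX∪Y))))
    where
    fX∪Y : Fragment k E (X ∪ Y)
    fX∪Y = union-fragment rE fX fY
      (≤-<-trans (maxY X fX) (fragment-smaller-than-exterior rE nf fY)) k≤1+X∩Y ∂X≤∂X∩Y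

-- Theorem 4.3.  In both parts, assume |X ∩ Y| ≥ k (resp. ≥ k - 1).  Then X ∩ Y
-- is admissible for κ_k (resp. κ_{k-1} = κ_k), so its board is at least |∂X|,
-- and super-fragments-meet yields a contradiction.
theorem4p3 : (n k : ℕ) → 1 ≤ k → (E : Graph n) → Reflexive E → Separable k E → ¬ Faithful k (rev E) →
    ((X Y : Subset n) → SuperFragment k E X → SuperFragment k E Y → X ≢ Y → ∣ X ∩ Y ∣ < k)
    × (2 ≤ k → (c : ℕ) → IsKappa k E c → IsKappa (k ∸ 1) E c →
       (X Y : Subset n) → SuperFragment k E X → SuperFragment k E Y → X ≢ Y → ∣ X ∩ Y ∣ < k ∸ 1)
theorem4p3 n k _ E rE _ nf = part-i , part-ii
  where
  part-i : (X Y : Subset n) → SuperFragment k E X → SuperFragment k E Y → X ≢ Y → ∣ X ∩ Y ∣ < k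
  part-i X Y sX@((admX , minX) , _) sY X≢Y = ≰⇒> λ k≤X∩Y →
    super-fragments-meet rE nf sX sY X≢Y (m≤n⇒m≤1+n k≤X∩Y)
      (minX _ (meet-admissible E X Y admX ≤-refl k≤X∩Y))

  part-ii : 2 ≤ k → (c : ℕ) → IsKappa k E c → IsKappa (k ∸ 1) E c →
    (X Y : Subset n) → SuperFragment k E X → SuperFragment k E Y → X ≢ Y → ∣ X ∩ Y ∣ < k ∸ 1
  part-ii _ c ((Z , admZ , ∂Z≡c) , _) (_ , c≤κₖ₋₁) X Y sX@((admX , minX) , _) sY X≢Y =
    ≰⇒> λ k-1≤X∩Y → super-fragments-meet rE nf sX sY X≢Y
      (≤-trans (m≤n+m∸n k 1) (s≤s k-1≤X∩Y))
      (begin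
        ∣ board E X ∣        ≤⟨ minX Z admZ ⟩
        ∣ board E Z ∣        ≡⟨ ∂Z≡c ⟩
        c                    ≤⟨ c≤κₖ₋₁ _ (meet-admissible E X Y admX (m∸n≤m k 1) k-1≤X∩Y) ⟩
        ∣ board E (X ∩ Y) ∣  ∎)
    where open ≤-Reasoning
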